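{- Let $(s_n)_{n\ge1}$ be the Look-Knave sequence, defined below. For every $n\ge1$, every maximal run of identical consecutive bits in $s_n$ has length at most $5$.
   Context: For a positive integer $m$, let $[m]$ denote the binary representation of $m$, with no leading zeros. For a finite binary string $s$, write $s=r_1r_2\cdots r_t$ as a concatenation of maximal runs: each $r_i$ is a nonempty block of a single repeated bit $b_i$, and consecutive runs use different bits. Define $$k(s)=[|r_1|]\,\overline{b_1}\,[|r_2|]\,\overline{b_2}\cdots[|r_t|]\,\overline{b_t},$$ where $\overline{b}$ denotes the complement of the bit $b$. The Look-Knave sequence is given by $s_1=1$ and $s_n=k(s_{n-1})$ for $n\ge2$. Its first terms are $1, 10, 1011, 1011100, \ldots$. -}

module Defs where

open import Data.Bool using (Bool; true; false; not; _∧_; if_then_else_)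
open import Data.Nat using (ℕ; zero; suc; _+_; _≤_)
open import Data.Nat.DivMod using (_/_; _%_)
open import Data.List using (List; []; _∷_; _++_; concatMap; reverse)
open import Data.Product using (_×_; _,_)
open import Relation.Binary.PropositionalEquality using (_≡_)

-- Bits: true = 1, false = 0. A binary string is a List Bool (leftmost = head).

-- bitsRev fuel m : binary digits of m, least significant first, no leading zeros
-- (empty for m = 0). Fuel ≥ m suffices, since m halves each step.
bitsRev : ℕ → ℕ → List Bool
bitsRev zero    m = []
bitsRev (suc f) zero = []
bitsRev (suc f) (suc m) = (if (suc m % 2) Data.Nat.≡ᵇ 1 then true else false) ∷ bitsRev f (suc m / 2)

bin : ℕ → List Bool
bin m = reverse (bitsRev m m)

-- Decomposition into maximal runs: list of (bit, run length), lengths ≥ 1,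
-- consecutive bits distinct.
runs : List Bool → List (Bool × ℕ)
runs [] = []
runs (b ∷ s) with runs s
... | [] = (b , 1) ∷ []
... | (c , n) ∷ rs = if eqb b c then (c , suc n) ∷ rs else (b , 1) ∷ (c , n) ∷ rs
  where
  eqb : Bool → Bool → Bool
  eqb true true = true
  eqb false false = true
  eqb _ _ = false

k : List Bool → List Bool
k s = concatMap (λ { (b , n) → bin n ++ (not b ∷ []) }) (runs s)

-- Look-Knave sequence, 1-indexed: s 1 = 1, s (n+1) = k (s n). (s 0 := 1 as well, unused.)
s : ℕ → List Bool
s zero = true ∷ []
s (suc zero) = true ∷ []
s (suc (suc n)) = k (s (suc n))

module Submission where

-- The term s (n+1) = k (s n) is the concatenation of blocks  bin m ++ [not b],
-- one for each run (b , m) of s n, and consecutive runs of s n alternate in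
-- their bit.  We compute the runs of a concatenation from right to left:
-- runs (b ∷ xs) is obtained from runs xs by `extend b`, which either lengthens
-- the leading run or opens a new one, so runs (w ++ v) = push w (runs v).
--
-- The invariant carried from right to left is `Ready c rs`: all runs of rs
-- are at most 5 long and a leading run of c's is at most 2 long.  Prepending
-- the block of a run (b , m) with m ≤ 5 turns `Ready (not b)` into `Ready b`:
-- its final bit not b joins a leading run of at most 2 (giving at most 3),
-- and then bin m (one of ε, 1, 10, 11, 100, 101) is pushed on top, a finite
-- check.  Since runs alternate, these invariants chain along the whole block
-- list, and induction on n finishes the proof.

open import Defs
open import Data.Bool using (Bool; true; false; not)
open import Data.Nat using (ℕ; zero; suc; _≤_; s≤s; z<s; sz<ss)
open import Data.Nat.Properties using (≤-refl; m≤n⇒m≤1+n)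
open import Data.Product using (_×_; _,_; proj₁; proj₂; ∃-syntax)
open import Data.List using (List; []; _∷_; _++_; foldr; concatMap)
open import Data.List.Properties using (foldr-++)
open import Data.List.Relation.Unary.All using (All; []; _∷_; lookup)
open import Data.List.Membership.Propositional using (_∈_)
open import Data.Unit using (⊤)
open import Relation.Binary.PropositionalEquality using (_≡_; refl; cong)

RunsBounded : List (Bool × ℕ) → Set
RunsBounded = All (λ r → proj₂ r ≤ 5)

extend : Bool → List (Bool × ℕ) → List (Bool × ℕ)
extend b [] = (b , 1) ∷ []
extend true  ((true  , n) ∷ rs) = (true  , suc n) ∷ rs
extend false ((false , n) ∷ rs) = (false , suc n) ∷ rs
extend true  ((false , n) ∷ rs) = (true  , 1) ∷ (false , n) ∷ rs
extend false ((true  , n) ∷ rs) = (false , 1) ∷ (true  , n) ∷ rs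

push : List Bool → List (Bool × ℕ) → List (Bool × ℕ)
push w rs = foldr extend rs w

runs-∷ : ∀ b xs → runs (b ∷ xs) ≡ extend b (runs xs)
runs-∷ b xs with runs xs
... | [] = refl
runs-∷ true  xs | (true  , n) ∷ rs = refl
runs-∷ true  xs | (false , n) ∷ rs = refl
runs-∷ false xs | (true  , n) ∷ rs = refl
runs-∷ false xs | (false , n) ∷ rs = refl

runs-++ : ∀ xs ys → runs (xs ++ ys) ≡ push xs (runs ys)
runs-++ [] ys = refl
runs-++ (x ∷ xs) ys rewrite runs-∷ x (xs ++ ys) = cong (extend x) (runs-++ xs ys)

data Alternating : Bool → List (Bool × ℕ) → Set where
  []  : ∀ {b} → Alternating b []
  _∷_ : ∀ {b rs} (n : ℕ) → Alternating (not b) rs → Alternating b ((b , n) ∷ rs)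

extend-alternating : ∀ b {c rs} → Alternating c rs → Alternating b (extend b rs)
extend-alternating b     []             = 1 ∷ []
extend-alternating true  {true}  (n ∷ a) = suc n ∷ a
extend-alternating false {false} (n ∷ a) = suc n ∷ a
extend-alternating true  {false} (n ∷ a) = 1 ∷ n ∷ a
extend-alternating false {true}  (n ∷ a) = 1 ∷ n ∷ a

runs-alternating : ∀ xs → ∃[ c ] Alternating c (runs xs)
runs-alternating [] = true , []
runs-alternating (x ∷ xs) rewrite runs-∷ x xs =
  x , extend-alternating x (proj₂ (runs-alternating xs))

LeadingRunAtMost : Bool → ℕ → List (Bool × ℕ) → Set
LeadingRunAtMost c k [] = ⊤
LeadingRunAtMost c k ((b , n) ∷ _) = b ≡ c → n ≤ k

-- rs may be preceded by a block ending in the bit c without creating a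
-- run longer than 5.
Ready : Bool → List (Bool × ℕ) → Set
Ready c rs = RunsBounded rs × LeadingRunAtMost c 2 rs

data ClosedBy (c : Bool) : List (Bool × ℕ) → Set where
  closed : ∀ {h rs} → h ≤ 3 → RunsBounded rs → ClosedBy c ((c , h) ∷ rs)

close-block : ∀ c {rs} → Ready c rs → ClosedBy c (extend c rs)
close-block c     {[]} _ = closed z<s []
close-block true  {(true  , h) ∷ _} (_ ∷ bs , lead) = closed (s≤s (lead refl)) bs
close-block false {(false , h) ∷ _} (_ ∷ bs , lead) = closed (s≤s (lead refl)) bs
close-block true  {(false , h) ∷ _} (bs , _) = closed z<s bs
close-block false {(true  , h) ∷ _} (bs , _) = closed z<s bs

h≤5 : ∀ {h} → h ≤ 3 → h ≤ 5
h≤5 p = m≤n⇒m≤1+n (m≤n⇒m≤1+n p)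

1+h≤5 : ∀ {h} → h ≤ 3 → suc h ≤ 5
1+h≤5 p = s≤s (m≤n⇒m≤1+n p)

2+h≤5 : ∀ {h} → h ≤ 3 → suc (suc h) ≤ 5
2+h≤5 p = s≤s (s≤s p)

-- Pushing bin m (m ≤ 5) onto a list closed by not b: every binary word
-- ε, 1, 10, 11, 100, 101 has at most two trailing equal bits and at most two
-- leading 1s.
open-block : ∀ b m → m ≤ 5 → ∀ {ts} → ClosedBy (not b) ts → Ready b (push (bin m) ts)
open-block _ (suc (suc (suc (suc (suc (suc _)))))) (s≤s (s≤s (s≤s (s≤s (s≤s ()))))) _
open-block true  0 _ (closed h≤3 bs) = (h≤5 h≤3 ∷ bs) , λ ()
open-block true  1 _ (closed h≤3 bs) = (z<s ∷ h≤5 h≤3 ∷ bs) , λ _ → z<s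
open-block true  2 _ (closed h≤3 bs) = (z<s ∷ 1+h≤5 h≤3 ∷ bs) , λ _ → z<s
open-block true  3 _ (closed h≤3 bs) = (sz<ss ∷ h≤5 h≤3 ∷ bs) , λ _ → ≤-refl
open-block true  4 _ (closed h≤3 bs) = (z<s ∷ 2+h≤5 h≤3 ∷ bs) , λ _ → z<s
open-block true  5 _ (closed h≤3 bs) = (z<s ∷ z<s ∷ z<s ∷ h≤5 h≤3 ∷ bs) , λ _ → z<s
open-block false 0 _ (closed h≤3 bs) = (h≤5 h≤3 ∷ bs) , λ ()
open-block false 1 _ (closed h≤3 bs) = (1+h≤5 h≤3 ∷ bs) , λ ()
open-block false 2 _ (closed h≤3 bs) = (z<s ∷ z<s ∷ h≤5 h≤3 ∷ bs) , λ ()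
open-block false 3 _ (closed h≤3 bs) = (2+h≤5 h≤3 ∷ bs) , λ ()
open-block false 4 _ (closed h≤3 bs) = (z<s ∷ sz<ss ∷ h≤5 h≤3 ∷ bs) , λ ()
open-block false 5 _ (closed h≤3 bs) = (z<s ∷ z<s ∷ 1+h≤5 h≤3 ∷ bs) , λ ()

block : Bool × ℕ → List Bool
block (b , m) = bin m ++ not b ∷ []

block-step : ∀ b m → m ≤ 5 → ∀ {rs} → Ready (not b) rs → Ready b (push (block (b , m)) rs)
block-step b m m≤5 {rs} r rewrite foldr-++ extend rs (bin m) (not b ∷ []) =
  open-block b m m≤5 (close-block (not b) r)

ready-blocks : ∀ {b rs} → Alternating b rs → RunsBounded rs → Ready b (runs (concatMap block rs))
ready-blocks [] [] = [] , _
ready-blocks {b} {(_ , m) ∷ rs} (_ ∷ a) (m≤5 ∷ bs)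
  rewrite runs-++ (block (b , m)) (concatMap block rs) =
  block-step b m m≤5 (ready-blocks a bs)

-- All runs of s (n + 1) have length at most 5.  Here k xs unfolds to
-- concatMap block (runs xs).
runs-bounded : ∀ n → RunsBounded (runs (s (suc n)))
runs-bounded zero = z<s ∷ []
runs-bounded (suc n) =
  proj₁ (ready-blocks (proj₂ (runs-alternating (s (suc n)))) (runs-bounded n))

lemma1 : (n : ℕ) → 1 ≤ n → (b : Bool) (len : ℕ) → (b , len) ∈ runs (s n) → len ≤ 5
lemma1 (suc n) _ _ _ run∈ = lookup (runs-bounded n) run∈
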